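{- Let $T$ be a weighted tree which is not a star. If $T$ has at least two adjacent pendant edges (i.e. two pendant edges sharing a common vertex), then the group inverse graph $T^{\#}$ is not a tree.
   Context: A weighted tree is a tree with a nonzero real weight on each edge; its adjacency matrix $A$ has $(i,j)$ entry equal to the weight of edge $v_iv_j$, or $0$ if there is no such edge. The group inverse $A^{\#}$ is the unique matrix $X$ with $AXA=A$, $XAX=X$, $AX=XA$ (it exists since $A$ is symmetric). The group inverse graph $T^{\#}$ is the weighted graph on the same vertex set in which $v_iv_j$ is an edge iff the $(i,j)$ entry of $A^{\#}$ is nonzero, weighted by that entry. A pendant edge is an edge incident to a vertex of degree one. -}

module Defs where

open import Level using (0ℓ)
open import Data.Nat using (ℕ; suc; _≤_)
open import Data.Fin using (Fin; zero; suc)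
open import Data.List using (List; []; _∷_; _++_; [_]; length)
open import Data.List.Relation.Unary.Linked using (Linked)
open import Data.List.Relation.Unary.Unique.Propositional using (Unique)
open import Data.Product using (Σ; ∃; _×_; _,_)
open import Data.Sum using (_⊎_)
open import Relation.Nullary using (¬_)
open import Relation.Binary.PropositionalEquality using (_≡_; _≢_)
open import Algebra.Bundles using (CommutativeRing)

-- The real numbers, axiomatised as a (Dedekind-)complete ordered field.
-- Every model is isomorphic to ℝ, so quantifying over all models is
-- the faithful rendering of "real weights".

record RealField : Set₁ where
  field
    commRing : CommutativeRing 0ℓ 0ℓ
  open CommutativeRing commRing public
  field
    0≉1     : ¬ (0# ≈ 1#)
    inverse : ∀ x → ¬ (x ≈ 0#) → Σ Carrier λ y → x * y ≈ 1#
    _<_         : Carrier → Carrier → Set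
    <-irrefl    : ∀ {x y} → x ≈ y → ¬ (x < y)
    <-trans     : ∀ {x y z} → x < y → y < z → x < z
    <-resp-≈    : ∀ {x x′ y y′} → x ≈ x′ → y ≈ y′ → x < y → x′ < y′
    <-trichotomy : ∀ x y → (x < y) ⊎ (x ≈ y) ⊎ (y < x)
    +-mono-<    : ∀ {x y} z → x < y → (x + z) < (y + z)
    *-pos       : ∀ {x y} → 0# < x → 0# < y → 0# < (x * y)
    sup : (P : Carrier → Set) → Σ Carrier P →
          Σ Carrier (λ b → ∀ x → P x → ¬ (b < x)) →
          Σ Carrier λ s → (∀ x → P x → ¬ (s < x)) ×
                          (∀ b → (∀ x → P x → ¬ (b < x)) → ¬ (b < s))

module _ {n : ℕ} (Adj : Fin n → Fin n → Set) where

  data Walk : Fin n → Fin n → Set where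
    here : ∀ {u} → Walk u u
    step : ∀ {u w v} → Adj u w → Walk w v → Walk u v

  Connected : Set
  Connected = ∀ u v → Walk u v

  Cycle : Set
  Cycle = Σ (Fin n) λ x → Σ (List (Fin n)) λ vs →
            (2 ≤ length vs) × Unique (x ∷ vs) × Linked Adj (x ∷ vs ++ [ x ])

  Acyclic : Set
  Acyclic = ¬ Cycle

  IsTree : Set
  IsTree = Connected × Acyclic

  Leaf : Fin n → Set
  Leaf v = Σ (Fin n) λ w → Adj v w × (∀ w′ → Adj v w′ → w′ ≡ w)

  PendantEdge : Fin n → Fin n → Set
  PendantEdge u v = Adj u v × (Leaf u ⊎ Leaf v)

  HasAdjacentPendantEdges : Set
  HasAdjacentPendantEdges = Σ (Fin n) λ x → Σ (Fin n) λ y → Σ (Fin n) λ z →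
    y ≢ z × PendantEdge x y × PendantEdge x z

  IsStar : Set
  IsStar = Σ (Fin n) λ c → ∀ v → v ≢ c → Adj c v

module _ (ℝ : RealField) where
  open RealField ℝ using (Carrier; _≈_; _+_; _*_; 0#)

  Matrix : ℕ → Set
  Matrix n = Fin n → Fin n → Carrier

  sumFin : ∀ {n} → (Fin n → Carrier) → Carrier
  sumFin {ℕ.zero} f = 0#
  sumFin {suc n} f = f zero + sumFin (λ i → f (suc i))

  _⊗_ : ∀ {n} → Matrix n → Matrix n → Matrix n
  (A ⊗ B) i j = sumFin λ k → A i k * B k j

  _≋_ : ∀ {n} → Matrix n → Matrix n → Set
  A ≋ B = ∀ i j → A i j ≈ B i j

  Symmetric : ∀ {n} → Matrix n → Set
  Symmetric A = ∀ i j → A i j ≈ A j i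

  GraphOf : ∀ {n} → Matrix n → Fin n → Fin n → Set
  GraphOf A i j = (i ≢ j) × ¬ (A i j ≈ 0#)

  IsWeightedTreeAdjacency : ∀ {n} → Matrix n → Set
  IsWeightedTreeAdjacency A =
    Symmetric A × (∀ i → A i i ≈ 0#) × IsTree (GraphOf A)

  IsGroupInverse : ∀ {n} → Matrix n → Matrix n → Set
  IsGroupInverse A X = (((A ⊗ X) ⊗ A) ≋ A) × (((X ⊗ A) ⊗ X) ≋ X) × ((A ⊗ X) ≋ (X ⊗ A))

-- Let y and z be leaves attached to x. Their rows in A are multiples of e_x, so X = A X²
-- makes the rows of X at y and z proportional; moreover X y x ≠ 0, for otherwise the
-- column x of the symmetric matrix X vanishes and A x y = (A X A) x y = 0. If X m y ≠ 0
-- for some m ∉ {x, y, z}, then y x z m is a 4-cycle of T#. Otherwise comparing the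
-- y-th columns of A X = X A gives X k x · A x y = A k x · X x y for all k ≠ x. Take i at
-- distance two from x (T is not a star): row i of A applied to this turns
-- (A X A) i y = A i y = 0 into (A²) i x · X x y = 0, whereas in a tree (A²) i x is the
-- single nonzero product along the path i k x.

module Submission where

open import Defs
open import Data.Nat using (ℕ; zero; suc; s≤s; z≤n)
open import Data.Fin using (Fin; zero; suc; _≟_; punchIn)
open import Data.Fin.Properties using (¬∀⟶∃¬; punchInᵢ≢i)
open import Data.List using ([]; _∷_)
open import Data.List.Relation.Unary.Linked using ([-]; _∷_)
open import Data.List.Relation.Unary.AllPairs using ([]; _∷_)
open import Data.List.Relation.Unary.All using ([]; _∷_)
open import Data.Product using (∃; ∃₂; _×_; _,_; proj₁; proj₂)
open import Data.Sum using (_⊎_; inj₁; inj₂; [_,_]′)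
open import Data.Empty using (⊥-elim)
open import Function using (_∘_; id; flip)
open import Relation.Binary.Bundles using (Setoid)
import Relation.Binary.Reasoning.Setoid
open import Relation.Nullary using (¬_; Dec; yes; no; contradiction)
open import Relation.Nullary.Decidable using (¬?; _×-dec_; _⊎-dec_)
open import Relation.Binary.PropositionalEquality as ≡ using (_≡_; _≢_; ≢-sym)

module _ {n : ℕ} {Adj : Fin n → Fin n → Set} where

  4-cycle : (∀ {u v} → Adj u v → u ≢ v) →
            ∀ {a b c d} → Adj a b → Adj b c → Adj c d → Adj d a → a ≢ c → b ≢ d →
            Cycle Adj
  4-cycle irrefl {a} {b} {c} {d} ab bc cd da a≢c b≢d =
    a , b ∷ c ∷ d ∷ [] , s≤s (s≤s z≤n) ,
    (irrefl ab ∷ a≢c ∷ ≢-sym (irrefl da) ∷ []) ∷ (irrefl bc ∷ b≢d ∷ []) ∷ (irrefl cd ∷ []) ∷ [] ∷ [] ,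
    ab ∷ bc ∷ cd ∷ da ∷ [-]

  acyclic⇒unique-common-neighbour :
    (∀ {u v} → Adj u v → u ≢ v) → Acyclic Adj →
    ∀ {x k i k′} → Adj x k → Adj k i → Adj i k′ → Adj k′ x → i ≢ x → k′ ≡ k
  acyclic⇒unique-common-neighbour irrefl acyclic {k = k} {k′ = k′} xk ki ik′ k′x i≢x with k′ ≟ k
  ... | yes k′≡k = k′≡k
  ... | no k′≢k = contradiction (4-cycle irrefl xk ki ik′ k′x (≢-sym i≢x) (≢-sym k′≢k)) acyclic

  walk-crosses-boundary : {P : Fin n → Set} → (∀ u → Dec (P u)) →
                          ∀ {u v} → Walk Adj u v → P u → ¬ P v →
                          ∃₂ λ k i → P k × Adj k i × ¬ P i
  walk-crosses-boundary P? here Pu ¬Pv = contradiction Pu ¬Pv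
  walk-crosses-boundary P? (step {w = w} uw wv) Pu ¬Pv with P? w
  ... | yes Pw = walk-crosses-boundary P? wv Pw ¬Pv
  ... | no ¬Pw = _ , w , Pu , uw , ¬Pw

  non-star⇒distance-two : (∀ u v → Dec (Adj u v)) → Connected Adj → ¬ IsStar Adj →
                          ∀ x → ∃₂ λ k i → Adj x k × Adj k i × i ≢ x × ¬ Adj x i
  non-star⇒distance-two Adj? connected not-star x =
    let v , v∉N[x] = ¬∀⟶∃¬ n N[x] N[x]? (not-star ∘ star)
    in leave (walk-crosses-boundary N[x]? (connected x v) (inj₁ ≡.refl) v∉N[x])
    where
    N[x] : Fin n → Set
    N[x] v = v ≡ x ⊎ Adj x v
    N[x]? : ∀ v → Dec (N[x] v)
    N[x]? v = (v ≟ x) ⊎-dec Adj? x v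
    star : (∀ v → N[x] v) → IsStar Adj
    star all = x , λ v v≢x → [ flip contradiction v≢x , id ]′ (all v)
    leave : (∃₂ λ k i → N[x] k × Adj k i × ¬ N[x] i) →
            ∃₂ λ k i → Adj x k × Adj k i × i ≢ x × ¬ Adj x i
    leave (k , i , inj₁ ≡.refl , xi , i∉N[x]) = contradiction (inj₂ xi) i∉N[x]
    leave (k , i , inj₂ xk , ki , i∉N[x]) = k , i , xk , ki , i∉N[x] ∘ inj₁ , i∉N[x] ∘ inj₂

  cherry-leaf : ∀ {x y z} → y ≢ z → Adj x z → PendantEdge Adj x y → Leaf Adj y
  cherry-leaf y≢z xz (xy , inj₁ (_ , _ , unique)) = contradiction (≡.trans (unique _ xy) (≡.sym (unique _ xz))) y≢z
  cherry-leaf y≢z xz (_ , inj₂ leaf) = leaf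

module _ (ℝ : RealField) where
  open RealField ℝ hiding (zero)
  open import Algebra.Properties.Ring ring using (-‿distribˡ-*; -‿distribʳ-*; -‿involutive)
  open import Algebra.Properties.Semiring.Sum semiring
    using (sum; sum-cong-≋; sum-cong-≗; sum-replicate-zero; sum-remove; ∑-comm; *-distribˡ-sum; *-distribʳ-sum)

  module ≈-Reasoning = Relation.Binary.Reasoning.Setoid setoid

  ≈0? : ∀ x → Dec (x ≈ 0#)
  ≈0? x with <-trichotomy x 0#
  ... | inj₁ x<0 = no λ x≈0 → <-irrefl x≈0 x<0
  ... | inj₂ (inj₁ x≈0) = yes x≈0
  ... | inj₂ (inj₂ 0<x) = no λ x≈0 → <-irrefl (sym x≈0) 0<x

  x*y≈0⇒y≈0 : ∀ {x y} → ¬ x ≈ 0# → x * y ≈ 0# → y ≈ 0#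
  x*y≈0⇒y≈0 {x} {y} x≉0 xy≈0 with inverse x x≉0
  ... | x⁻¹ , xx⁻¹≈1 = begin
    y                ≈⟨ *-identityˡ y ⟨
    1# * y           ≈⟨ *-congʳ (trans (sym xx⁻¹≈1) (*-comm x x⁻¹)) ⟩
    x⁻¹ * x * y      ≈⟨ *-assoc x⁻¹ x y ⟩
    x⁻¹ * (x * y)    ≈⟨ *-congˡ xy≈0 ⟩
    x⁻¹ * 0#         ≈⟨ zeroʳ x⁻¹ ⟩
    0#               ∎
    where open ≈-Reasoning

  x*y≉0 : ∀ {x y} → ¬ x ≈ 0# → ¬ y ≈ 0# → ¬ x * y ≈ 0#
  x*y≉0 x≉0 y≉0 = y≉0 ∘ x*y≈0⇒y≈0 x≉0

  NonNegative : Carrier → Set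
  NonNegative x = 0# < x ⊎ 0# ≈ x

  0<+0≤⇒0< : ∀ {x y} → 0# < x → NonNegative y → 0# < (x + y)
  0<+0≤⇒0< {x} {y} 0<x (inj₁ 0<y) = <-trans (<-resp-≈ refl (sym (+-identityˡ y)) 0<y) (+-mono-< y 0<x)
  0<+0≤⇒0< {x} {y} 0<x (inj₂ 0≈y) = <-resp-≈ refl (trans (sym (+-identityʳ x)) (+-congˡ 0≈y)) 0<x

  0≤+0≤⇒0≤ : ∀ {x y} → NonNegative x → NonNegative y → NonNegative (x + y)
  0≤+0≤⇒0≤ (inj₁ 0<x) 0≤y = inj₁ (0<+0≤⇒0< 0<x 0≤y)
  0≤+0≤⇒0≤ {x} {y} (inj₂ 0≈x) (inj₁ 0<y) = inj₁ (<-resp-≈ refl (trans (sym (+-identityˡ y)) (+-congʳ 0≈x)) 0<y)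
  0≤+0≤⇒0≤ (inj₂ 0≈x) (inj₂ 0≈y) = inj₂ (trans (sym (+-identityˡ 0#)) (+-cong 0≈x 0≈y))

  x≉0⇒0<x*x : ∀ {x} → ¬ x ≈ 0# → 0# < (x * x)
  x≉0⇒0<x*x {x} x≉0 with <-trichotomy x 0#
  ... | inj₁ x<0 = <-resp-≈ refl -x*-x≈x*x (*-pos 0<-x 0<-x)
    where
    0<-x : 0# < (- x)
    0<-x = <-resp-≈ (-‿inverseʳ x) (+-identityˡ (- x)) (+-mono-< (- x) x<0)
    -x*-x≈x*x : - x * - x ≈ x * x
    -x*-x≈x*x = trans (sym (-‿distribˡ-* x (- x)))
                      (trans (-‿cong (sym (-‿distribʳ-* x x))) (-‿involutive (x * x)))
  ... | inj₂ (inj₁ x≈0) = contradiction x≈0 x≉0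
  ... | inj₂ (inj₂ 0<x) = *-pos 0<x 0<x

  0≤x*x : ∀ x → NonNegative (x * x)
  0≤x*x x with ≈0? x
  ... | yes x≈0 = inj₂ (sym (trans (*-congʳ x≈0) (zeroˡ x)))
  ... | no x≉0 = inj₁ (x≉0⇒0<x*x x≉0)

  sum-zero : ∀ {n} {f : Fin n → Carrier} → (∀ i → f i ≈ 0#) → sum f ≈ 0#
  sum-zero {n} f≈0 = trans (sum-cong-≋ f≈0) (sum-replicate-zero n)

  sum-single : ∀ {n} (f : Fin n → Carrier) i → (∀ j → j ≢ i → f j ≈ 0#) → sum f ≈ f i
  sum-single {suc n} f i f≈0 = begin
    sum f                      ≈⟨ sum-remove f ⟩
    f i + sum (f ∘ punchIn i)  ≈⟨ +-congˡ (sum-zero λ j → f≈0 (punchIn i j) (punchInᵢ≢i i j)) ⟩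
    f i + 0#                   ≈⟨ +-identityʳ (f i) ⟩
    f i                        ∎
    where open ≈-Reasoning

  sum-nonneg : ∀ {n} {f : Fin n → Carrier} → (∀ i → NonNegative (f i)) → NonNegative (sum f)
  sum-nonneg {zero} _ = inj₂ refl
  sum-nonneg {suc n} 0≤f = 0≤+0≤⇒0≤ (0≤f zero) (sum-nonneg (0≤f ∘ suc))

  sum-squares≈0 : ∀ {n} (f : Fin n → Carrier) → sum (λ i → f i * f i) ≈ 0# → ∀ i → f i ≈ 0#
  sum-squares≈0 {suc n} f ∑≈0 i with ≈0? (f i)
  ... | yes fi≈0 = fi≈0
  ... | no fi≉0 = ⊥-elim (<-irrefl (sym ∑≈0) 0<∑)
    where
    0<∑ : 0# < sum (λ j → f j * f j)
    0<∑ = <-resp-≈ refl (sym (sum-remove (λ j → f j * f j)))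
                   (0<+0≤⇒0< (x≉0⇒0<x*x fi≉0) (sum-nonneg (λ j → 0≤x*x (f (punchIn i j)))))

  infixl 7 _*ₘ_
  _*ₘ_ : ∀ {n} → Matrix ℝ n → Matrix ℝ n → Matrix ℝ n
  _*ₘ_ = _⊗_ ℝ

  infix 4 _≈ₘ_
  _≈ₘ_ : ∀ {n} → Matrix ℝ n → Matrix ℝ n → Set
  _≈ₘ_ = _≋_ ℝ

  _ᵀ : ∀ {n} → Matrix ℝ n → Matrix ℝ n
  (A ᵀ) i j = A j i

  ≈ₘ-setoid : ℕ → Setoid _ _
  ≈ₘ-setoid n = record
    { Carrier = Matrix ℝ n
    ; _≈_ = _≈ₘ_
    ; isEquivalence = record
      { refl = λ i j → refl
      ; sym = λ A≈B i j → sym (A≈B i j)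
      ; trans = λ A≈B B≈C i j → trans (A≈B i j) (B≈C i j)
      }
    }

  module ≈ₘ-Reasoning {n} = Relation.Binary.Reasoning.Setoid (≈ₘ-setoid n)

  sumFin≡sum : ∀ {n} (f : Fin n → Carrier) → sumFin ℝ f ≡ sum f
  sumFin≡sum {zero} f = ≡.refl
  sumFin≡sum {suc n} f = ≡.cong (f zero +_) (sumFin≡sum (f ∘ suc))

  *ₘ≡sum : ∀ {n} (A B : Matrix ℝ n) i j → (A *ₘ B) i j ≡ sum (λ k → A i k * B k j)
  *ₘ≡sum A B i j = sumFin≡sum (λ k → A i k * B k j)

  *ₘ-cong : ∀ {n} {A A′ B B′ : Matrix ℝ n} → A ≈ₘ A′ → B ≈ₘ B′ → A *ₘ B ≈ₘ A′ *ₘ B′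
  *ₘ-cong {A = A} {A′} {B} {B′} A≈A′ B≈B′ i j = begin
    (A *ₘ B) i j                    ≡⟨ *ₘ≡sum A B i j ⟩
    sum (λ k → A i k * B k j)       ≈⟨ sum-cong-≋ (λ k → *-cong (A≈A′ i k) (B≈B′ k j)) ⟩
    sum (λ k → A′ i k * B′ k j)     ≡⟨ *ₘ≡sum A′ B′ i j ⟨
    (A′ *ₘ B′) i j                  ∎
    where open ≈-Reasoning

  *ₘ-assoc : ∀ {n} (A B C : Matrix ℝ n) → (A *ₘ B) *ₘ C ≈ₘ A *ₘ (B *ₘ C)
  *ₘ-assoc A B C i j = begin
    ((A *ₘ B) *ₘ C) i j
      ≡⟨ *ₘ≡sum (A *ₘ B) C i j ⟩
    sum (λ k → (A *ₘ B) i k * C k j)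
      ≡⟨ sum-cong-≗ (λ k → ≡.cong (_* C k j) (*ₘ≡sum A B i k)) ⟩
    sum (λ k → sum (λ m → A i m * B m k) * C k j)
      ≈⟨ sum-cong-≋ (λ k → *-distribʳ-sum (C k j) (λ m → A i m * B m k)) ⟩
    sum (λ k → sum (λ m → A i m * B m k * C k j))
      ≈⟨ ∑-comm (λ k m → A i m * B m k * C k j) ⟩
    sum (λ m → sum (λ k → A i m * B m k * C k j))
      ≈⟨ sum-cong-≋ (λ m → sum-cong-≋ (λ k → *-assoc (A i m) (B m k) (C k j))) ⟩
    sum (λ m → sum (λ k → A i m * (B m k * C k j)))
      ≈⟨ sum-cong-≋ (λ m → *-distribˡ-sum (A i m) (λ k → B m k * C k j)) ⟨
    sum (λ m → A i m * sum (λ k → B m k * C k j))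
      ≡⟨ sum-cong-≗ (λ m → ≡.cong (A i m *_) (*ₘ≡sum B C m j)) ⟨
    sum (λ m → A i m * (B *ₘ C) m j)
      ≡⟨ *ₘ≡sum A (B *ₘ C) i j ⟨
    (A *ₘ (B *ₘ C)) i j
      ∎
    where open ≈-Reasoning

  ᵀ-*ₘ : ∀ {n} (A B : Matrix ℝ n) → (A *ₘ B) ᵀ ≈ₘ B ᵀ *ₘ A ᵀ
  ᵀ-*ₘ A B i j = begin
    (A *ₘ B) j i                ≡⟨ *ₘ≡sum A B j i ⟩
    sum (λ k → A j k * B k i)   ≈⟨ sum-cong-≋ (λ k → *-comm (A j k) (B k i)) ⟩
    sum (λ k → B k i * A j k)   ≡⟨ *ₘ≡sum (B ᵀ) (A ᵀ) i j ⟨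
    (B ᵀ *ₘ A ᵀ) i j            ∎
    where open ≈-Reasoning

  *ₘ-single : ∀ {n} (A B : Matrix ℝ n) {i j} x → (∀ k → k ≢ x → A i k * B k j ≈ 0#) →
              (A *ₘ B) i j ≈ A i x * B x j
  *ₘ-single A B {i} {j} x vanish =
    trans (reflexive (*ₘ≡sum A B i j)) (sum-single (λ k → A i k * B k j) x vanish)

  *ₘ-row-single : ∀ {n} (A B : Matrix ℝ n) {i j} x → (∀ k → k ≢ x → A i k ≈ 0#) →
                  (A *ₘ B) i j ≈ A i x * B x j
  *ₘ-row-single A B x Aik≈0 = *ₘ-single A B x λ k k≢x → trans (*-congʳ (Aik≈0 k k≢x)) (zeroˡ _)

  *ₘ-column-single : ∀ {n} (A B : Matrix ℝ n) {i j} x → (∀ k → k ≢ x → B k j ≈ 0#) →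
                     (A *ₘ B) i j ≈ A i x * B x j
  *ₘ-column-single A B x Bkj≈0 = *ₘ-single A B x λ k k≢x → trans (*-congˡ (Bkj≈0 k k≢x)) (zeroʳ _)

  *ₘ-congˡ : ∀ {n} {A B B′ : Matrix ℝ n} → B ≈ₘ B′ → A *ₘ B ≈ₘ A *ₘ B′
  *ₘ-congˡ = *ₘ-cong λ _ _ → refl

  *ₘ-congʳ : ∀ {n} {A A′ B : Matrix ℝ n} → A ≈ₘ A′ → A *ₘ B ≈ₘ A′ *ₘ B
  *ₘ-congʳ A≈A′ = *ₘ-cong A≈A′ λ _ _ → refl

  ᵀ-cong : ∀ {n} {A B : Matrix ℝ n} → A ≈ₘ B → A ᵀ ≈ₘ B ᵀ
  ᵀ-cong A≈B i j = A≈B j i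

  ᵀ-*ₘ³ : ∀ {n} (A B C : Matrix ℝ n) → (A *ₘ B *ₘ C) ᵀ ≈ₘ C ᵀ *ₘ B ᵀ *ₘ A ᵀ
  ᵀ-*ₘ³ A B C = begin
    (A *ₘ B *ₘ C) ᵀ          ≈⟨ ᵀ-*ₘ (A *ₘ B) C ⟩
    C ᵀ *ₘ (A *ₘ B) ᵀ        ≈⟨ *ₘ-congˡ (ᵀ-*ₘ A B) ⟩
    C ᵀ *ₘ (B ᵀ *ₘ A ᵀ)      ≈⟨ *ₘ-assoc (C ᵀ) (B ᵀ) (A ᵀ) ⟨
    C ᵀ *ₘ B ᵀ *ₘ A ᵀ        ∎
    where open ≈ₘ-Reasoning

  groupInverse-unique : ∀ {n} {A X Y : Matrix ℝ n} →
                        IsGroupInverse ℝ A X → IsGroupInverse ℝ A Y → X ≈ₘ Y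
  groupInverse-unique {A = A} {X} {Y} (AXA≈A , XAX≈X , AX≈XA) (AYA≈A , YAY≈Y , AY≈YA) = begin
    X                 ≈⟨ XAX≈X ⟨
    X *ₘ A *ₘ X       ≈⟨ *ₘ-assoc X A X ⟩
    X *ₘ (A *ₘ X)     ≈⟨ *ₘ-congˡ AX≈AY ⟩
    X *ₘ (A *ₘ Y)     ≈⟨ *ₘ-assoc X A Y ⟨
    X *ₘ A *ₘ Y       ≈⟨ *ₘ-congʳ (begin
                           X *ₘ A   ≈⟨ AX≈XA ⟨
                           A *ₘ X   ≈⟨ AX≈AY ⟩
                           A *ₘ Y   ≈⟨ AY≈YA ⟩
                           Y *ₘ A   ∎) ⟩
    Y *ₘ A *ₘ Y       ≈⟨ YAY≈Y ⟩
    Y                 ∎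
    where
    open ≈ₘ-Reasoning
    AX≈AY : A *ₘ X ≈ₘ A *ₘ Y
    AX≈AY = begin
      A *ₘ X                ≈⟨ *ₘ-congʳ AYA≈A ⟨
      A *ₘ Y *ₘ A *ₘ X      ≈⟨ *ₘ-assoc (A *ₘ Y) A X ⟩
      A *ₘ Y *ₘ (A *ₘ X)    ≈⟨ *ₘ-cong AY≈YA AX≈XA ⟩
      Y *ₘ A *ₘ (X *ₘ A)    ≈⟨ *ₘ-assoc Y A (X *ₘ A) ⟩
      Y *ₘ (A *ₘ (X *ₘ A))  ≈⟨ *ₘ-congˡ (*ₘ-assoc A X A) ⟨
      Y *ₘ (A *ₘ X *ₘ A)    ≈⟨ *ₘ-congˡ AXA≈A ⟩
      Y *ₘ A                ≈⟨ AY≈YA ⟨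
      A *ₘ Y                ∎

  groupInverse-ᵀ : ∀ {n} {A X : Matrix ℝ n} → Symmetric ℝ A →
                   IsGroupInverse ℝ A X → IsGroupInverse ℝ A (X ᵀ)
  groupInverse-ᵀ {A = A} {X} A≈Aᵀ (AXA≈A , XAX≈X , AX≈XA) = AXᵀA≈A , XᵀAXᵀ≈Xᵀ , AXᵀ≈XᵀA
    where
    open ≈ₘ-Reasoning
    AXᵀA≈A : A *ₘ X ᵀ *ₘ A ≈ₘ A
    AXᵀA≈A = begin
      A *ₘ X ᵀ *ₘ A          ≈⟨ *ₘ-cong (*ₘ-congʳ A≈Aᵀ) A≈Aᵀ ⟩
      A ᵀ *ₘ X ᵀ *ₘ A ᵀ      ≈⟨ ᵀ-*ₘ³ A X A ⟨
      (A *ₘ X *ₘ A) ᵀ        ≈⟨ ᵀ-cong AXA≈A ⟩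
      A ᵀ                    ≈⟨ A≈Aᵀ ⟨
      A                      ∎
    XᵀAXᵀ≈Xᵀ : X ᵀ *ₘ A *ₘ X ᵀ ≈ₘ X ᵀ
    XᵀAXᵀ≈Xᵀ = begin
      X ᵀ *ₘ A *ₘ X ᵀ        ≈⟨ *ₘ-congʳ (*ₘ-congˡ A≈Aᵀ) ⟩
      X ᵀ *ₘ A ᵀ *ₘ X ᵀ      ≈⟨ ᵀ-*ₘ³ X A X ⟨
      (X *ₘ A *ₘ X) ᵀ        ≈⟨ ᵀ-cong XAX≈X ⟩
      X ᵀ                    ∎
    AXᵀ≈XᵀA : A *ₘ X ᵀ ≈ₘ X ᵀ *ₘ A
    AXᵀ≈XᵀA = begin
      A *ₘ X ᵀ               ≈⟨ *ₘ-congʳ A≈Aᵀ ⟩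
      A ᵀ *ₘ X ᵀ             ≈⟨ ᵀ-*ₘ X A ⟨
      (X *ₘ A) ᵀ             ≈⟨ ᵀ-cong AX≈XA ⟨
      (A *ₘ X) ᵀ             ≈⟨ ᵀ-*ₘ A X ⟩
      X ᵀ *ₘ A ᵀ             ≈⟨ *ₘ-congˡ A≈Aᵀ ⟨
      X ᵀ *ₘ A               ∎

  groupInverse-symmetric : ∀ {n} {A X : Matrix ℝ n} → Symmetric ℝ A →
                           IsGroupInverse ℝ A X → Symmetric ℝ X
  groupInverse-symmetric A-sym X-inv = groupInverse-unique X-inv (groupInverse-ᵀ A-sym X-inv)

  groupInverse-factor : ∀ {n} {A X : Matrix ℝ n} → IsGroupInverse ℝ A X → X ≈ₘ A *ₘ (X *ₘ X)
  groupInverse-factor {A = A} {X} (_ , XAX≈X , AX≈XA) = begin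
    X                 ≈⟨ XAX≈X ⟨
    X *ₘ A *ₘ X       ≈⟨ *ₘ-congʳ AX≈XA ⟨
    A *ₘ X *ₘ X       ≈⟨ *ₘ-assoc A X X ⟩
    A *ₘ (X *ₘ X)     ∎
    where open ≈ₘ-Reasoning

  groupInverse-row-single : ∀ {n} {A X : Matrix ℝ n} → IsGroupInverse ℝ A X →
                            ∀ {v} x → (∀ k → k ≢ x → A v k ≈ 0#) →
                            ∀ c → X v c ≈ A v x * (X *ₘ X) x c
  groupInverse-row-single {A = A} {X} X-inv {v} x Avk≈0 c =
    trans (groupInverse-factor X-inv v c) (*ₘ-row-single A (X *ₘ X) x Avk≈0)

  groupInverse-pendant≉0 : ∀ {n} {A X : Matrix ℝ n} → Symmetric ℝ A → IsGroupInverse ℝ A X →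
                           ∀ {x y} → ¬ A x y ≈ 0# → (∀ k → k ≢ x → A y k ≈ 0#) → ¬ X y x ≈ 0#
  groupInverse-pendant≉0 {A = A} {X} A-sym X-inv@(AXA≈A , _ , _) {x} {y} Axy≉0 Ayk≈0 Xyx≈0 =
    Axy≉0 (begin
      A x y                  ≈⟨ AXA≈A x y ⟨
      (A *ₘ X *ₘ A) x y      ≈⟨ *ₘ-column-single (A *ₘ X) A x (λ k k≢x → trans (A-sym k y) (Ayk≈0 k k≢x)) ⟩
      (A *ₘ X) x x * A x y   ≈⟨ *-congʳ AXxx≈0 ⟩
      0# * A x y             ≈⟨ zeroˡ (A x y) ⟩
      0#                     ∎)
    where
    open ≈-Reasoning
    X²xx≈0 : (X *ₘ X) x x ≈ 0#
    X²xx≈0 = x*y≈0⇒y≈0 (Axy≉0 ∘ trans (A-sym x y))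
                        (trans (sym (groupInverse-row-single X-inv x Ayk≈0 x)) Xyx≈0)
    column-x≈0 : ∀ k → X k x ≈ 0#
    column-x≈0 = sum-squares≈0 (λ k → X k x) (begin
      sum (λ k → X k x * X k x)   ≈⟨ sum-cong-≋ (λ k → *-congʳ (groupInverse-symmetric A-sym X-inv k x)) ⟩
      sum (λ k → X x k * X k x)   ≡⟨ *ₘ≡sum X X x x ⟨
      (X *ₘ X) x x                ≈⟨ X²xx≈0 ⟩
      0#                          ∎)
    AXxx≈0 : (A *ₘ X) x x ≈ 0#
    AXxx≈0 = trans (*ₘ-column-single A X x (λ k _ → column-x≈0 k)) (trans (*-congˡ (column-x≈0 x)) (zeroʳ _))

  GraphOf? : ∀ {n} (A : Matrix ℝ n) i j → Dec (GraphOf ℝ A i j)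
  GraphOf? A i j = ¬? (i ≟ j) ×-dec ¬? (≈0? (A i j))

  GraphOf-sym : ∀ {n} {A : Matrix ℝ n} → Symmetric ℝ A → ∀ {i j} → GraphOf ℝ A i j → GraphOf ℝ A j i
  GraphOf-sym A-sym {i} {j} (i≢j , Aij≉0) = ≢-sym i≢j , Aij≉0 ∘ trans (A-sym i j)

  ¬GraphOf⇒≈0 : ∀ {n} {A : Matrix ℝ n} {i j} → i ≢ j → ¬ GraphOf ℝ A i j → A i j ≈ 0#
  ¬GraphOf⇒≈0 {A = A} {i} {j} i≢j i≁j with ≈0? (A i j)
  ... | yes Aij≈0 = Aij≈0
  ... | no Aij≉0 = contradiction (i≢j , Aij≉0) i≁j

  ≉0⇒GraphOf : ∀ {n} {A : Matrix ℝ n} → (∀ i → A i i ≈ 0#) → ∀ {i j} → ¬ A i j ≈ 0# → GraphOf ℝ A i j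
  ≉0⇒GraphOf A-diag {i} Aij≉0 = (λ { ≡.refl → Aij≉0 (A-diag i) }) , Aij≉0

  leaf-row : ∀ {n} {A : Matrix ℝ n} → (∀ i → A i i ≈ 0#) →
             ∀ {x y} → Leaf (GraphOf ℝ A) y → GraphOf ℝ A y x → ∀ k → k ≢ x → A y k ≈ 0#
  leaf-row {A = A} A-diag {x} {y} (_ , _ , unique) y~x k k≢x with ≈0? (A y k)
  ... | yes Ayk≈0 = Ayk≈0
  ... | no Ayk≉0 = contradiction (≡.trans (unique k (≉0⇒GraphOf A-diag Ayk≉0)) (≡.sym (unique x y~x))) k≢x

  distance-two⇒A²≉0 : ∀ {n} {A : Matrix ℝ n} → Symmetric ℝ A → (∀ i → A i i ≈ 0#) →
                      Acyclic (GraphOf ℝ A) → ∀ {x k i} → GraphOf ℝ A x k → GraphOf ℝ A k i → i ≢ x →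
                      ¬ (A *ₘ A) i x ≈ 0#
  distance-two⇒A²≉0 {A = A} A-sym A-diag acyclic {x} {k} {i} x~k k~i i≢x =
    x*y≉0 (proj₂ (GraphOf-sym A-sym k~i)) (proj₂ (GraphOf-sym A-sym x~k))
    ∘ trans (sym (*ₘ-single A A k other-paths≈0))
    where
    other-paths≈0 : ∀ k′ → k′ ≢ k → A i k′ * A k′ x ≈ 0#
    other-paths≈0 k′ k′≢k with ≈0? (A i k′) | ≈0? (A k′ x)
    ... | yes Aik′≈0 | _ = trans (*-congʳ Aik′≈0) (zeroˡ _)
    ... | no _ | yes Ak′x≈0 = trans (*-congˡ Ak′x≈0) (zeroʳ _)
    ... | no Aik′≉0 | no Ak′x≉0 = contradiction
      (acyclic⇒unique-common-neighbour proj₁ acyclic x~k k~i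
         (≉0⇒GraphOf A-diag Aik′≉0) (≉0⇒GraphOf A-diag Ak′x≉0) i≢x)
      k′≢k

  module Cherry {n} {A X : Matrix ℝ n} (A-sym : Symmetric ℝ A) (X-inv : IsGroupInverse ℝ A X)
                {x y z : Fin n} (y≢z : y ≢ z) (x~y : GraphOf ℝ A x y) (x~z : GraphOf ℝ A x z)
                (Ayk≈0 : ∀ k → k ≢ x → A y k ≈ 0#) (Azk≈0 : ∀ k → k ≢ x → A z k ≈ 0#) where

    open ≈-Reasoning

    X-sym : Symmetric ℝ X
    X-sym = groupInverse-symmetric A-sym X-inv

    Xyx≉0 : ¬ X y x ≈ 0#
    Xyx≉0 = groupInverse-pendant≉0 A-sym X-inv (proj₂ x~y) Ayk≈0

    twins : ∀ c → ¬ X y c ≈ 0# → ¬ X z c ≈ 0#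
    twins c Xyc≉0 Xzc≈0 = Xyc≉0 (begin
      X y c                   ≈⟨ groupInverse-row-single X-inv x Ayk≈0 c ⟩
      A y x * (X *ₘ X) x c    ≈⟨ *-congˡ X²xc≈0 ⟩
      A y x * 0#              ≈⟨ zeroʳ (A y x) ⟩
      0#                      ∎)
      where
      X²xc≈0 : (X *ₘ X) x c ≈ 0#
      X²xc≈0 = x*y≈0⇒y≈0 (proj₂ (GraphOf-sym A-sym x~z))
                          (trans (sym (groupInverse-row-single X-inv x Azk≈0 c)) Xzc≈0)

    module _ (X-acyclic : Acyclic (GraphOf ℝ X)) where

      column-y-support : ∀ m → m ≢ x → m ≢ y → m ≢ z → X m y ≈ 0#
      column-y-support m m≢x m≢y m≢z with ≈0? (X m y)
      ... | yes Xmy≈0 = Xmy≈0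
      ... | no Xmy≉0 = contradiction (4-cycle proj₁ yx xz zm my y≢z (≢-sym m≢x)) X-acyclic
        where
        yx : GraphOf ℝ X y x
        yx = ≢-sym (proj₁ x~y) , Xyx≉0
        xz : GraphOf ℝ X x z
        xz = proj₁ x~z , twins x Xyx≉0 ∘ trans (X-sym z x)
        zm : GraphOf ℝ X z m
        zm = ≢-sym m≢z , twins m (Xmy≉0 ∘ trans (X-sym m y))
        my : GraphOf ℝ X m y
        my = m≢y , Xmy≉0

      column-x-relation : ∀ k → k ≢ x → X k x * A x y ≈ A k x * X x y
      column-x-relation k k≢x = begin
        X k x * A x y   ≈⟨ *ₘ-column-single X A x (λ m m≢x → trans (A-sym m y) (Ayk≈0 m m≢x)) ⟨
        (X *ₘ A) k y    ≈⟨ proj₂ (proj₂ X-inv) k y ⟨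
        (A *ₘ X) k y    ≈⟨ *ₘ-single A X x off-x ⟩
        A k x * X x y   ∎
        where
        off-x : ∀ m → m ≢ x → A k m * X m y ≈ 0#
        off-x m m≢x with m ≟ y | m ≟ z
        ... | yes ≡.refl | _ = trans (*-congʳ (trans (A-sym k y) (Ayk≈0 k k≢x))) (zeroˡ _)
        ... | no _ | yes ≡.refl = trans (*-congʳ (trans (A-sym k z) (Azk≈0 k k≢x))) (zeroˡ _)
        ... | no m≢y | no m≢z = trans (*-congˡ (column-y-support m m≢x m≢y m≢z)) (zeroʳ _)

      A²X≈AXA : ∀ i → A i x ≈ 0# → (A *ₘ A) i x * X x y ≈ (A *ₘ X) i x * A x y
      A²X≈AXA i Aix≈0 = begin
        (A *ₘ A) i x * X x y                ≡⟨ ≡.cong (_* X x y) (*ₘ≡sum A A i x) ⟩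
        sum (λ k → A i k * A k x) * X x y   ≈⟨ *-distribʳ-sum (X x y) (λ k → A i k * A k x) ⟩
        sum (λ k → A i k * A k x * X x y)   ≈⟨ sum-cong-≋ swap-through ⟩
        sum (λ k → A i k * X k x * A x y)   ≈⟨ *-distribʳ-sum (A x y) (λ k → A i k * X k x) ⟨
        sum (λ k → A i k * X k x) * A x y   ≡⟨ ≡.cong (_* A x y) (*ₘ≡sum A X i x) ⟨
        (A *ₘ X) i x * A x y                ∎
        where
        via-x≈0 : ∀ u v → A i x * u * v ≈ 0#
        via-x≈0 u v = trans (*-congʳ (trans (*-congʳ Aix≈0) (zeroˡ u))) (zeroˡ v)
        swap-through : ∀ k → A i k * A k x * X x y ≈ A i k * X k x * A x y
        swap-through k with k ≟ x
        ... | yes ≡.refl = trans (via-x≈0 _ _) (sym (via-x≈0 _ _))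
        ... | no k≢x = begin
          A i k * A k x * X x y     ≈⟨ *-assoc (A i k) (A k x) (X x y) ⟩
          A i k * (A k x * X x y)   ≈⟨ *-congˡ (column-x-relation k k≢x) ⟨
          A i k * (X k x * A x y)   ≈⟨ *-assoc (A i k) (X k x) (A x y) ⟨
          A i k * X k x * A x y     ∎

      A²-off-neighbourhood≈0 : ∀ i → i ≢ x → A i x ≈ 0# → (A *ₘ A) i x ≈ 0#
      A²-off-neighbourhood≈0 i i≢x Aix≈0 = x*y≈0⇒y≈0 Xxy≉0 (begin
        X x y * (A *ₘ A) i x       ≈⟨ *-comm (X x y) ((A *ₘ A) i x) ⟩
        (A *ₘ A) i x * X x y       ≈⟨ A²X≈AXA i Aix≈0 ⟩
        (A *ₘ X) i x * A x y       ≈⟨ *ₘ-column-single (A *ₘ X) A x (λ k k≢x → trans (A-sym k y) (Ayk≈0 k k≢x)) ⟨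
        (A *ₘ X *ₘ A) i y          ≈⟨ proj₁ X-inv i y ⟩
        A i y                      ≈⟨ A-sym i y ⟩
        A y i                      ≈⟨ Ayk≈0 i i≢x ⟩
        0#                         ∎)
        where
        Xxy≉0 : ¬ X x y ≈ 0#
        Xxy≉0 = Xyx≉0 ∘ trans (X-sym y x)

lemma2p8 : (ℝ : RealField) (n : ℕ) (A : Matrix ℝ n) →
    IsWeightedTreeAdjacency ℝ A →
    ¬ IsStar (GraphOf ℝ A) →
    HasAdjacentPendantEdges (GraphOf ℝ A) →
    (X : Matrix ℝ n) → IsGroupInverse ℝ A X →
    ¬ IsTree (GraphOf ℝ X)
lemma2p8 ℝ n A (A-sym , A-diag , A-connected , A-acyclic) not-star
         (x , y , z , y≢z , pendant-xy@(x~y , _) , pendant-xz@(x~z , _)) X X-inv (_ , X-acyclic) =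
  let k , i , x~k , k~i , i≢x , x≁i = non-star⇒distance-two (GraphOf? ℝ A) A-connected not-star x
  in distance-two⇒A²≉0 ℝ A-sym A-diag A-acyclic x~k k~i i≢x
       (A²-off-neighbourhood≈0 X-acyclic i i≢x (trans (A-sym i x) (¬GraphOf⇒≈0 ℝ {A = A} (≢-sym i≢x) x≁i)))
  where
  open RealField ℝ using (_≈_; 0#; trans)
  pendant-row : ∀ {y z} → y ≢ z → GraphOf ℝ A x z → PendantEdge (GraphOf ℝ A) x y →
                ∀ k → k ≢ x → A y k ≈ 0#
  pendant-row y≢z x~z pendant-xy =
    leaf-row ℝ A-diag (cherry-leaf {Adj = GraphOf ℝ A} y≢z x~z pendant-xy) (GraphOf-sym ℝ A-sym (proj₁ pendant-xy))
  open Cherry ℝ A-sym X-inv y≢z x~y x~z (pendant-row y≢z x~z pendant-xy) (pendant-row (≢-sym y≢z) x~y pendant-xz)
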